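{- Let $r,k\ge1$ be integers. Let $\Gamma=(A,B,E)$ be a complete bipartite graph with parts $A,B$ where $|A|=r+1$ and $|B|=rk+1$, and let $c:E\to[r]$ be any coloring of its edges. Then there exists $B'\subset B$ with $|B'|\ge k+1$ such that for every $2$-element subset $\{b_1,b_2\}\subset B'$ there exists a $2$-element subset $v\subset A$ such that $\{b_1,b_2\}$ and $v$ are $c$-matchable, i.e., one can write $v=\{a_1,a_2\}$ with $a_1\ne a_2$ and $c(a_1b_1)=c(a_2b_2)$.
   Context: $[r]=\{1,\dots,r\}$; $ab$ denotes the edge between $a\in A$ and $b\in B$. -}

module Defs where

open import Data.Nat using (ℕ; suc; _*_; _+_)
open import Data.Fin using (Fin)
open import Data.Product using (∃₂; _×_)
open import Relation.Binary.PropositionalEquality using (_≡_; _≢_)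

-- Edge colouring of the complete bipartite graph with parts A = Fin (r+1), B = Fin (r*k+1),
-- colours in [r] represented by Fin r.  The edge ab is the pair (a , b).
Colouring : ℕ → ℕ → Set
Colouring r k = Fin (suc r) → Fin (suc (r * k)) → Fin r

Matchable : ∀ {r k} → Colouring r k → Fin (suc (r * k)) → Fin (suc (r * k)) → Set
Matchable c b₁ b₂ = ∃₂ λ a₁ a₂ → (a₁ ≢ a₂) × (c a₁ b₁ ≡ c a₂ b₂)

module Submission where

open import Defs
open import Data.Bool using (Bool; true; false; if_then_else_)
open import Data.Fin using (Fin; zero; suc)
open import Data.Fin.Properties using (_≟_; any?; pigeonhole; <⇒≢)
open import Data.Fin.Subset using (Subset; _∈_; ∣_∣)
open import Data.Nat using (ℕ; zero; suc; _*_; _≤_; _<_; _<?_; z≤n; NonZero)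
open import Data.Nat.Properties
  using (+-0-commutativeMonoid; +-mono-≤; ≮⇒≥; <-irrefl; n<1+n; module ≤-Reasoning)
open import Algebra.Properties.CommutativeMonoid.Sum +-0-commutativeMonoid
  using (∑-comm; sum-cong-≗; sum-replicate-zero; sum-syntax)
open import Data.Product using (Σ; ∃; ∃₂; _×_; _,_; proj₁; proj₂)
open import Data.Vec using (tabulate)
open import Data.Vec.Properties using (lookup∘tabulate; []=⇒lookup)
open import Function using (_∘_)
open import Relation.Binary.PropositionalEquality
  using (_≡_; _≢_; refl; sym; trans; cong; subst; module ≡-Reasoning)
open import Relation.Nullary using (yes; no; does; contradiction)

-- Every b ∈ B has, by pigeonhole on its r + 1 edges, two vertices of A joined to it in a common
-- colour κ(b); by the generalised pigeonhole principle some colour equals κ(b) for k + 1 vertices b.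
-- Given two of them, with pairs {a₁, a₂} for b₁ and {a₁′, a₂′} for b₂, either a₁ ≠ a₁′ or a₂ ≠ a₁′,
-- and that pair matches {b₁, b₂}, both of its edges having the common colour.

indicator : Bool → ℕ
indicator b = if b then 1 else 0

∣tabulate∣≡∑ : ∀ {n} (p : Fin n → Bool) → ∣ tabulate p ∣ ≡ ∑[ i < n ] indicator (p i)
∣tabulate∣≡∑ {zero}  p = refl
∣tabulate∣≡∑ {suc n} p with p zero
... | true  = cong suc (∣tabulate∣≡∑ (p ∘ suc))
... | false = ∣tabulate∣≡∑ (p ∘ suc)

∑-const-1 : ∀ n → ∑[ i < n ] 1 ≡ n
∑-const-1 zero    = refl
∑-const-1 (suc n) = cong suc (∑-const-1 n)

∑-≤ : ∀ {r k} (g : Fin r → ℕ) → (∀ i → g i ≤ k) → ∑[ i < r ] g i ≤ r * k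
∑-≤ {zero}  g g≤k = z≤n
∑-≤ {suc r} g g≤k = +-mono-≤ (g≤k zero) (∑-≤ (g ∘ suc) (g≤k ∘ suc))

∑-indicator-≡ : ∀ {r} (y : Fin r) → ∑[ x < r ] indicator (does (y ≟ x)) ≡ 1
∑-indicator-≡ {suc r} zero    = cong suc (sum-replicate-zero r)
∑-indicator-≡ {suc r} (suc y) = ∑-indicator-≡ y

fibre : ∀ {n r} → (Fin n → Fin r) → Fin r → Subset n
fibre f x = tabulate (λ b → does (f b ≟ x))

∈fibre⇒≡ : ∀ {n r} {f : Fin n → Fin r} {x b} → b ∈ fibre f x → f b ≡ x
∈fibre⇒≡ {f = f} {x} {b} b∈fibre
  with f b ≟ x | trans (sym (lookup∘tabulate (λ b → does (f b ≟ x)) b)) ([]=⇒lookup b∈fibre)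
... | yes fb≡x | _  = fb≡x
... | no _     | ()

∑∣fibre∣≡n : ∀ {n r} (f : Fin n → Fin r) → ∑[ x < r ] ∣ fibre f x ∣ ≡ n
∑∣fibre∣≡n {n} {r} f = begin
  ∑[ x < r ] ∣ fibre f x ∣                            ≡⟨ sum-cong-≗ (λ x → ∣tabulate∣≡∑ (λ b → does (f b ≟ x))) ⟩
  ∑[ x < r ] ∑[ b < n ] indicator (does (f b ≟ x))    ≡⟨ ∑-comm (λ x b → indicator (does (f b ≟ x))) ⟩
  ∑[ b < n ] ∑[ x < r ] indicator (does (f b ≟ x))    ≡⟨ sum-cong-≗ (λ b → ∑-indicator-≡ (f b)) ⟩
  ∑[ b < n ] 1                                        ≡⟨ ∑-const-1 n ⟩
  n                                                   ∎
  where open ≡-Reasoning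

pigeonhole-fibre : ∀ {n r} k → r * k < n → (f : Fin n → Fin r) → ∃ λ x → k < ∣ fibre f x ∣
pigeonhole-fibre {n} {r} k rk<n f with any? (λ x → k <? ∣ fibre f x ∣)
... | yes large = large
... | no ¬large = contradiction (begin-strict
  n                          ≡⟨ sym (∑∣fibre∣≡n f) ⟩
  ∑[ x < r ] ∣ fibre f x ∣   ≤⟨ ∑-≤ _ (λ x → ≮⇒≥ (¬large ∘ (x ,_))) ⟩
  r * k                      <⟨ rk<n ⟩
  n                          ∎) (<-irrefl refl)
  where open ≤-Reasoning

module _ {r k : ℕ} (c : Colouring r k) where

  MonochromaticPair : Fin (suc (r * k)) → Fin r → Set
  MonochromaticPair b x = ∃₂ λ a₁ a₂ → a₁ ≢ a₂ × c a₁ b ≡ x × c a₂ b ≡ x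

  monochromaticPair : ∀ b → Σ (Fin r) (MonochromaticPair b)
  monochromaticPair b with i , j , i<j , cib≡cjb ← pigeonhole (n<1+n r) (λ a → c a b)
    = c i b , i , j , <⇒≢ i<j , refl , sym cib≡cjb

  matchable : ∀ {b₁ b₂ x} → MonochromaticPair b₁ x → MonochromaticPair b₂ x → Matchable c b₁ b₂
  matchable (a₁ , a₂ , a₁≢a₂ , ca₁≡x , ca₂≡x) (a₁′ , _ , _ , ca₁′≡x , _) with a₁ ≟ a₁′
  ... | no a₁≢a₁′ = a₁ , a₁′ , a₁≢a₁′ , trans ca₁≡x (sym ca₁′≡x)
  ... | yes refl  = a₂ , a₁ , a₁≢a₂ ∘ sym , trans ca₂≡x (sym ca₁′≡x)

lemma4 : (r k : ℕ) → .{{NonZero r}} → .{{NonZero k}} → (c : Colouring r k) →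
    Σ (Subset (suc (r * k))) λ B′ → (suc k ≤ ∣ B′ ∣) ×
      (∀ b₁ b₂ → b₁ ∈ B′ → b₂ ∈ B′ → b₁ ≢ b₂ → Matchable c b₁ b₂)
lemma4 r k c = fibre κ x , k<∣B′∣ , λ b₁ b₂ b₁∈B′ b₂∈B′ _ →
  matchable c (pairOfColour b₁∈B′) (pairOfColour b₂∈B′)
  where
  κ : Fin (suc (r * k)) → Fin r
  κ b = proj₁ (monochromaticPair c b)

  x : Fin r
  x = proj₁ (pigeonhole-fibre k (n<1+n (r * k)) κ)

  k<∣B′∣ : k < ∣ fibre κ x ∣
  k<∣B′∣ = proj₂ (pigeonhole-fibre k (n<1+n (r * k)) κ)

  pairOfColour : ∀ {b} → b ∈ fibre κ x → MonochromaticPair c b x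
  pairOfColour {b} b∈B′ =
    subst (MonochromaticPair c b) (∈fibre⇒≡ {f = κ} b∈B′) (proj₂ (monochromaticPair c b))
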